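{- There exists a planar graph $G$ for which $D_{\Gamma(G)+1}(G)$ is not connected.
   Context: All graphs are finite, simple and undirected. A set $S\subseteq V(G)$ is a dominating set of $G$ if every vertex of $V(G)\setminus S$ is adjacent to a vertex of $S$; $\Gamma(G)$ denotes the maximum cardinality of a minimal (with respect to inclusion) dominating set of $G$. For a positive integer $k$, the $k$-dominating graph $D_k(G)$ has as vertices the dominating sets of $G$ of cardinality at most $k$, two such sets being adjacent iff their symmetric difference consists of exactly one vertex of $G$. -}

module Defs where

open import Data.Nat using (ℕ; _≤_; _+_)
open import Data.Bool using (Bool; true; false)
open import Data.Fin using (Fin)
open import Data.Fin.Subset using (Subset; _∈_; _∉_; _⊆_; ∣_∣)
open import Data.Product using (Σ; ∃; ∃-syntax; _×_; _,_)
open import Data.Sum using (_⊎_)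
open import Data.Vec using (lookup)
open import Relation.Nullary using (¬_)
open import Relation.Binary.PropositionalEquality using (_≡_; _≢_)
open import Relation.Binary.Construct.Closure.ReflexiveTransitive using (Star)
open import Data.Rational using (ℚ; 0ℚ; 1ℚ) renaming (_+_ to _+ℚ_; _*_ to _*ℚ_; _-_ to _-ℚ_; _≤_ to _≤ℚ_)

record Graph : Set where
  field
    n     : ℕ
    adj   : Fin n → Fin n → Bool
    sym   : ∀ u v → adj u v ≡ adj v u
    irrefl : ∀ v → adj v v ≡ false

open Graph public

Adj : (G : Graph) → Fin (n G) → Fin (n G) → Set
Adj G u v = adj G u v ≡ true

Dominating : (G : Graph) → Subset (n G) → Set
Dominating G S = ∀ v → v ∉ S → ∃[ u ] (u ∈ S × Adj G v u)

MinimalDominating : (G : Graph) → Subset (n G) → Set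
MinimalDominating G S =
  Dominating G S × (∀ T → T ⊆ S → Dominating G T → T ≡ S)

IsUpperDomination : (G : Graph) → ℕ → Set
IsUpperDomination G k =
  (∃[ S ] (MinimalDominating G S × ∣ S ∣ ≡ k)) ×
  (∀ S → MinimalDominating G S → ∣ S ∣ ≤ k)

DkVertex : (G : Graph) → ℕ → Set
DkVertex G k = Σ (Subset (n G)) λ S → Dominating G S × ∣ S ∣ ≤ k

DiffByOne : {m : ℕ} → Subset m → Subset m → Set
DiffByOne S T = ∃[ v ] ((lookup S v ≢ lookup T v) ×
                        (∀ w → w ≢ v → lookup S w ≡ lookup T w))

DkAdj : (G : Graph) (k : ℕ) → DkVertex G k → DkVertex G k → Set
DkAdj G k (S , _) (T , _) = DiffByOne S T

Connected : (V : Set) → (V → V → Set) → Set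
Connected V E = ∀ x y → Star E x y

-- Planarity: a straight-line plane drawing with rational coordinates
-- (equivalent to planarity by Fáry's theorem)

Point : Set
Point = ℚ × ℚ

OnSegment : Point → Point → Point → Set
OnSegment (x₁ , x₂) (p₁ , p₂) (q₁ , q₂) =
  ∃[ t ] ((0ℚ ≤ℚ t) × (t ≤ℚ 1ℚ) ×
          (x₁ ≡ p₁ +ℚ (t *ℚ (q₁ -ℚ p₁))) ×
          (x₂ ≡ p₂ +ℚ (t *ℚ (q₂ -ℚ p₂))))

record PlaneDrawing (G : Graph) : Set where
  field
    pos : Fin (n G) → Point
    injective : ∀ u v → pos u ≡ pos v → u ≡ v
    vertexOffEdges : ∀ a b c → Adj G a b → OnSegment (pos c) (pos a) (pos b) →
                     (c ≡ a) ⊎ (c ≡ b)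
    edgesMeetAtEnds : ∀ a b c d → Adj G a b → Adj G c d → ∀ x →
                      OnSegment x (pos a) (pos b) → OnSegment x (pos c) (pos d) →
                      ((a ≡ c × b ≡ d) ⊎ (a ≡ d × b ≡ c)) ⊎
                      (((a ≡ c ⊎ a ≡ d) × x ≡ pos a) ⊎ ((b ≡ c ⊎ b ≡ d) × x ≡ pos b))

Planar : Graph → Set
Planar G = PlaneDrawing G

-- G consists of three nested triangles 012, 345, 678, each vertex i of the middle
-- triangle being joined to i + 3 and i + 6.  In D₄(G) the middle triangle can never
-- be broken up: removing a vertex m of it from a dominating set of size at most 4
-- that contains it leaves at most three vertices, two of them in the middle
-- triangle, and the third would have to dominate both m + 3 and m + 6, whose closed
-- neighbourhoods meet only in m.  Hence {0,1,2} and {3,4,5,8} lie in different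
-- components of D₄(G), while Γ(G) = 3.  All finite facts about G follow by
-- exhausting its 2⁹ vertex subsets, and G is planar because it has a straight-line
-- drawing in which any two segments that must not meet are strictly separated by a
-- linear functional.
module Submission where

open import Defs hiding (sym)
open import Data.Bool using (Bool; true; false; _∧_; _∨_)
open import Data.Bool.ListAction using (any)
open import Data.Bool.Properties using (∨-comm) renaming (_≟_ to _≟ᵇ_)
open import Data.Empty using (⊥; ⊥-elim)
open import Data.Fin using (Fin; #_)
open import Data.Fin.Properties using (_≟_; all?; any?)
open import Data.Fin.Subset using (Subset; _∈_; _∉_; _⊆_; ∣_∣; _-_; _∪_; ⁅_⁆)
open import Data.Fin.Subset.Properties
  using (_∈?_; _⊆?_; anySubset?; x∈p⇒p-x⊂p; x∈p⇒∣p-x∣<∣p∣; x∈p∧x≢y⇒x∈p-y;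
         p⊆q⇒∣p∣≤∣q∣; p⊆p∪q; q⊆p∪q; x∈⁅x⁆)
open import Data.Integer using (-[1+_]; +≤+)
import Data.Integer as ℤ
open import Data.List using (List; []; _∷_; map; cartesianProduct)
open import Data.List.Relation.Unary.Any using (Any)
import Data.List.Relation.Unary.Any as Any
open import Data.Nat using (ℕ; _+_; _≤_; _≤?_; z≤n; s≤s⁻¹)
open import Data.Nat.Properties using (≤-<-trans; <-≤-trans)
open import Data.Product using (∃; ∃-syntax; _×_; _,_; proj₁)
open import Data.Product.Properties using (≡-dec)
open import Data.Rational
  using (ℚ; 0ℚ; 1ℚ; -_; _/_; _⊔_; _⊓_; *≤*; nonNegative; positive)
  renaming (_+_ to _+ℚ_; _*_ to _*ℚ_; _-_ to _-ℚ_; _≤_ to _≤ℚ_; _<_ to _<ℚ_)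
import Data.Rational.Properties as ℚ
open import Data.Rational.Solver using (module +-*-Solver)
open import Data.Sum using (_⊎_; inj₁; inj₂)
open import Data.Vec using (_∷_; []; lookup)
open import Data.Vec.Properties using ([]=⇒lookup; lookup⇒[]=) renaming (≡-dec to ≡-decᵛ)
open import Function using (_∘_; id)
open import Relation.Binary.Construct.Closure.ReflexiveTransitive using (fold)
open import Relation.Binary.PropositionalEquality
open import Relation.Nullary using (¬_; Dec; does; yes; no; contradiction)
open import Relation.Nullary.Decidable
  using (¬?; _×-dec_; _→-dec_; from-yes; from-no; decidable-stable; map′)
open import Relation.Unary using (Pred; Decidable)

allSubsets? : ∀ {n p} {P : Pred (Subset n) p} → Decidable P → Dec (∀ S → P S)
allSubsets? P? = map′ (λ ∄¬P S → decidable-stable (P? S) (λ ¬PS → ∄¬P (S , ¬PS)))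
                      (λ ∀P (S , ¬PS) → ¬PS (∀P S))
                      (¬? (anySubset? (¬? ∘ P?)))

dominating? : (G : Graph) → Decidable (Dominating G)
dominating? G S = all? λ v → ¬? (v ∈? S) →-dec any? λ u → u ∈? S ×-dec adj G v u ≟ᵇ true

minimalDominating? : (G : Graph) → Decidable (MinimalDominating G)
minimalDominating? G S = dominating? G S ×-dec
  allSubsets? λ T → T ⊆? S →-dec dominating? G T →-dec ≡-decᵛ _≟ᵇ_ T S

minimal⇒¬dominating-removal : ∀ G {S v} → MinimalDominating G S → v ∈ S → ¬ Dominating G (S - v)
minimal⇒¬dominating-removal G (_ , minimal) v∈S dom
  with S-v⊆S , (w , w∈S , w∉S-v) ← x∈p⇒p-x⊂p v∈S
  = subst (w ∉_) (minimal _ S-v⊆S dom) w∉S-v w∈S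

invariant⇒¬connected : ∀ {V : Set} {E : V → V → Set} (P : V → Set) →
                       (∀ {x y} → E x y → P x → P y) →
                       ∀ x y → P x → ¬ P y → ¬ Connected V E
invariant⇒¬connected P step x y Px ¬Py connected =
  ¬Py (fold (λ u v → P u → P v) (λ e k → k ∘ step e) id (connected x y) Px)

∈-agree : ∀ {m} {S U : Subset m} {w} → lookup S w ≡ lookup U w → w ∈ S → w ∈ U
∈-agree {U = U} {w} eq w∈S = lookup⇒[]= w U (trans (sym eq) ([]=⇒lookup w∈S))

open +-*-Solver

infix 8 _∙_

_∙_ : ℚ × ℚ → Point → ℚ
(α , β) ∙ (x , y) = α *ℚ x +ℚ β *ℚ y

interpolate-convex : ∀ t a b → a +ℚ t *ℚ (b -ℚ a) ≡ (1ℚ -ℚ t) *ℚ a +ℚ t *ℚ b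
interpolate-convex = solve 3 (λ t a b → a :+ t :* (b :- a) := (con 1ℚ :- t) :* a :+ t :* b) refl

convex-const : ∀ t c → (1ℚ -ℚ t) *ℚ c +ℚ t *ℚ c ≡ c
convex-const = solve 2 (λ t c → (con 1ℚ :- t) :* c :+ t :* c := c) refl

interpolate-0 : ∀ a b → a +ℚ 0ℚ *ℚ (b -ℚ a) ≡ a
interpolate-0 = solve 2 (λ a b → a :+ con 0ℚ :* (b :- a) := a) refl

interpolate-flip : ∀ t a b → a +ℚ t *ℚ (b -ℚ a) ≡ b +ℚ (1ℚ -ℚ t) *ℚ (a -ℚ b)
interpolate-flip = solve 3 (λ t a b → a :+ t :* (b :- a) := b :+ (con 1ℚ :- t) :* (a :- b)) refl

0≤1-t : ∀ {t} → t ≤ℚ 1ℚ → 0ℚ ≤ℚ 1ℚ -ℚ t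
0≤1-t {t} t≤1 = subst (_≤ℚ 1ℚ -ℚ t) (ℚ.+-inverseʳ t) (ℚ.+-monoˡ-≤ (- t) t≤1)

1-t≤1 : ∀ {t} → 0ℚ ≤ℚ t → 1ℚ -ℚ t ≤ℚ 1ℚ
1-t≤1 0≤t = ℚ.+-monoʳ-≤ 1ℚ (ℚ.neg-antimono-≤ 0≤t)

module _ {t : ℚ} (0≤t : 0ℚ ≤ℚ t) (t≤1 : t ≤ℚ 1ℚ) where

  private
    convex-mono-≤ : ∀ {a b c d} → a ≤ℚ c → b ≤ℚ d →
                    (1ℚ -ℚ t) *ℚ a +ℚ t *ℚ b ≤ℚ (1ℚ -ℚ t) *ℚ c +ℚ t *ℚ d
    convex-mono-≤ a≤c b≤d =
      ℚ.+-mono-≤ (ℚ.*-monoˡ-≤-nonNeg (1ℚ -ℚ t) {{nonNegative (0≤1-t t≤1)}} a≤c)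
                 (ℚ.*-monoˡ-≤-nonNeg t {{nonNegative 0≤t}} b≤d)

  interpolate-≤ : ∀ {a b c} → a ≤ℚ c → b ≤ℚ c → a +ℚ t *ℚ (b -ℚ a) ≤ℚ c
  interpolate-≤ {a} {b} {c} a≤c b≤c = begin
    a +ℚ t *ℚ (b -ℚ a)        ≡⟨ interpolate-convex t a b ⟩
    (1ℚ -ℚ t) *ℚ a +ℚ t *ℚ b  ≤⟨ convex-mono-≤ a≤c b≤c ⟩
    (1ℚ -ℚ t) *ℚ c +ℚ t *ℚ c  ≡⟨ convex-const t c ⟩
    c                         ∎
    where open ℚ.≤-Reasoning

  interpolate-≥ : ∀ {a b c} → c ≤ℚ a → c ≤ℚ b → c ≤ℚ a +ℚ t *ℚ (b -ℚ a)
  interpolate-≥ {a} {b} {c} c≤a c≤b = begin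
    c                         ≡⟨ convex-const t c ⟨
    (1ℚ -ℚ t) *ℚ c +ℚ t *ℚ c  ≤⟨ convex-mono-≤ c≤a c≤b ⟩
    (1ℚ -ℚ t) *ℚ a +ℚ t *ℚ b  ≡⟨ interpolate-convex t a b ⟨
    a +ℚ t *ℚ (b -ℚ a)        ∎
    where open ℚ.≤-Reasoning

interpolate-≥-start⇒t≡0 : ∀ {t a b} → 0ℚ ≤ℚ t → b <ℚ a → a ≤ℚ a +ℚ t *ℚ (b -ℚ a) → t ≡ 0ℚ
interpolate-≥-start⇒t≡0 {t} {a} {b} 0≤t b<a a≤ with 0ℚ ℚ.<? t
... | no 0≮t = ℚ.≤-antisym (ℚ.≮⇒≥ 0≮t) 0≤t
... | yes 0<t = contradiction (ℚ.≤-<-trans a≤ below) (ℚ.<-irrefl refl)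
  where
  open ℚ.≤-Reasoning
  b-a<0 : b -ℚ a <ℚ 0ℚ
  b-a<0 = subst (b -ℚ a <ℚ_) (ℚ.+-inverseʳ a) (ℚ.+-monoˡ-< (- a) b<a)
  below : a +ℚ t *ℚ (b -ℚ a) <ℚ a
  below = begin-strict
    a +ℚ t *ℚ (b -ℚ a)  <⟨ ℚ.+-monoʳ-< a (ℚ.*-monoʳ-<-pos t {{positive 0<t}} b-a<0) ⟩
    a +ℚ t *ℚ 0ℚ        ≡⟨ cong (a +ℚ_) (ℚ.*-zeroʳ t) ⟩
    a +ℚ 0ℚ             ≡⟨ ℚ.+-identityʳ a ⟩
    a                   ∎

∙-onSegment : ∀ f x p q (o : OnSegment x p q) → f ∙ x ≡ f ∙ p +ℚ proj₁ o *ℚ (f ∙ q -ℚ f ∙ p)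
∙-onSegment (α , β) _ (p₁ , p₂) (q₁ , q₂) (t , _ , _ , refl , refl) =
  solve 7 (λ α β p₁ p₂ q₁ q₂ t →
             α :* (p₁ :+ t :* (q₁ :- p₁)) :+ β :* (p₂ :+ t :* (q₂ :- p₂))
          := α :* p₁ :+ β :* p₂ :+ t :* (α :* q₁ :+ β :* q₂ :- (α :* p₁ :+ β :* p₂)))
    refl α β p₁ p₂ q₁ q₂ t

onSegment-start : ∀ p q → OnSegment p p q
onSegment-start (p₁ , p₂) (q₁ , q₂) =
  0ℚ , ℚ.≤-refl , *≤* (+≤+ z≤n) , sym (interpolate-0 p₁ q₁) , sym (interpolate-0 p₂ q₂)

onSegment-sym : ∀ x p q → OnSegment x p q → OnSegment x q p
onSegment-sym _ (p₁ , p₂) (q₁ , q₂) (t , 0≤t , t≤1 , refl , refl) =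
  1ℚ -ℚ t , 0≤1-t t≤1 , 1-t≤1 0≤t , interpolate-flip t p₁ q₁ , interpolate-flip t p₂ q₂

onSegment-at-0 : ∀ x p q (o : OnSegment x p q) → proj₁ o ≡ 0ℚ → x ≡ p
onSegment-at-0 _ (p₁ , p₂) (q₁ , q₂) (_ , _ , _ , refl , refl) refl =
  cong₂ _,_ (interpolate-0 p₁ q₁) (interpolate-0 p₂ q₂)

∙-onSegment-≤-⊔ : ∀ f x p q → OnSegment x p q → f ∙ x ≤ℚ f ∙ p ⊔ f ∙ q
∙-onSegment-≤-⊔ f x p q o@(_ , 0≤t , t≤1 , _) =
  subst (_≤ℚ f ∙ p ⊔ f ∙ q) (sym (∙-onSegment f x p q o))
        (interpolate-≤ 0≤t t≤1 (ℚ.p≤p⊔q (f ∙ p) (f ∙ q)) (ℚ.p≤q⊔p (f ∙ p) (f ∙ q)))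

∙-onSegment-≥-⊓ : ∀ f x p q → OnSegment x p q → f ∙ p ⊓ f ∙ q ≤ℚ f ∙ x
∙-onSegment-≥-⊓ f x p q o@(_ , 0≤t , t≤1 , _) =
  subst (f ∙ p ⊓ f ∙ q ≤ℚ_) (sym (∙-onSegment f x p q o))
        (interpolate-≥ 0≤t t≤1 (ℚ.p⊓q≤p (f ∙ p) (f ∙ q)) (ℚ.p⊓q≤q (f ∙ p) (f ∙ q)))

SeparatedBy : Point → Point → Point → Point → ℚ × ℚ → Set
SeparatedBy p q r s f = f ∙ p ⊔ f ∙ q <ℚ f ∙ r ⊓ f ∙ s

-- f strictly decreases from p towards q and does not decrease from p towards r,
-- so the segments [p, q] and [p, r] meet only in p.
ApexSeparatedBy : Point → Point → Point → ℚ × ℚ → Set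
ApexSeparatedBy p q r f = f ∙ q <ℚ f ∙ p × f ∙ p ≤ℚ f ∙ r

separatedBy? : ∀ p q r s → Decidable (SeparatedBy p q r s)
separatedBy? p q r s f = f ∙ p ⊔ f ∙ q ℚ.<? f ∙ r ⊓ f ∙ s

apexSeparatedBy? : ∀ p q r → Decidable (ApexSeparatedBy p q r)
apexSeparatedBy? p q r f = f ∙ q ℚ.<? f ∙ p ×-dec f ∙ p ℚ.≤? f ∙ r

separated⇒disjoint : ∀ x p q r s → ∃ (SeparatedBy p q r s) →
                     OnSegment x p q → OnSegment x r s → ⊥
separated⇒disjoint x p q r s (f , sep) x∈pq x∈rs =
  ℚ.<-irrefl refl (ℚ.≤-<-trans (∙-onSegment-≤-⊔ f x p q x∈pq)
                               (ℚ.<-≤-trans sep (∙-onSegment-≥-⊓ f x r s x∈rs)))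

apexSeparated⇒apex : ∀ x p q r → ∃ (ApexSeparatedBy p q r) →
                     OnSegment x p q → OnSegment x p r → x ≡ p
apexSeparated⇒apex x p q r (f , fq<fp , fp≤fr) x∈pq@(_ , 0≤t , _) x∈pr =
  onSegment-at-0 x p q x∈pq (interpolate-≥-start⇒t≡0 0≤t fq<fp fp≤fx)
  where
  fp≤fx : f ∙ p ≤ℚ f ∙ p +ℚ proj₁ x∈pq *ℚ (f ∙ q -ℚ f ∙ p)
  fp≤fx = subst₂ _≤ℚ_ (ℚ.p≤q⇒p⊓q≡p fp≤fr) (∙-onSegment f x p q x∈pq)
                 (∙-onSegment-≥-⊓ f x p r x∈pr)

record SeparationCertificate (G : Graph) (pos : Fin (n G) → Point) : Set where
  field
    injective       : ∀ u v → pos u ≡ pos v → u ≡ v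
    vertexSeparated : ∀ a b c → Adj G a b → c ≢ a → c ≢ b →
                      ∃ (SeparatedBy (pos a) (pos b) (pos c) (pos c))
    apexSeparated   : ∀ p q r → Adj G p q → Adj G p r → q ≢ r →
                      ∃ (ApexSeparatedBy (pos p) (pos q) (pos r))
    edgesSeparated  : ∀ a b c d → Adj G a b → Adj G c d → a ≢ c → a ≢ d → b ≢ c → b ≢ d →
                      ∃ (SeparatedBy (pos a) (pos b) (pos c) (pos d))

Adj-sym : ∀ G {u v} → Adj G u v → Adj G v u
Adj-sym G {u} {v} uv = trans (Graph.sym G v u) uv

module _ {G : Graph} {pos : Fin (n G) → Point} (cert : SeparationCertificate G pos) where

  open SeparationCertificate cert

  certified-vertexOffEdges : ∀ a b c → Adj G a b → OnSegment (pos c) (pos a) (pos b) →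
                             c ≡ a ⊎ c ≡ b
  certified-vertexOffEdges a b c ab c∈ab with c ≟ a | c ≟ b
  ... | yes c≡a | _       = inj₁ c≡a
  ... | no _    | yes c≡b = inj₂ c≡b
  ... | no c≢a  | no c≢b  =
    ⊥-elim (separated⇒disjoint (pos c) (pos a) (pos b) (pos c) (pos c)
              (vertexSeparated a b c ab c≢a c≢b) c∈ab (onSegment-start (pos c) (pos c)))

  private
    meetAtApex : ∀ {p q r} x → Adj G p q → Adj G p r → q ≢ r →
                 OnSegment x (pos p) (pos q) → OnSegment x (pos p) (pos r) → x ≡ pos p
    meetAtApex {p} {q} {r} x pq pr q≢r =
      apexSeparated⇒apex x (pos p) (pos q) (pos r) (apexSeparated p q r pq pr q≢r)

    reverse : ∀ {x u v} → OnSegment x (pos u) (pos v) → OnSegment x (pos v) (pos u)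
    reverse {x} {u} {v} = onSegment-sym x (pos u) (pos v)

  certified-edgesMeetAtEnds : ∀ a b c d → Adj G a b → Adj G c d → ∀ x →
    OnSegment x (pos a) (pos b) → OnSegment x (pos c) (pos d) →
    ((a ≡ c × b ≡ d) ⊎ (a ≡ d × b ≡ c)) ⊎
    (((a ≡ c ⊎ a ≡ d) × x ≡ pos a) ⊎ ((b ≡ c ⊎ b ≡ d) × x ≡ pos b))
  certified-edgesMeetAtEnds a b c d ab cd x x∈ab x∈cd with a ≟ c | a ≟ d | b ≟ c | b ≟ d
  ... | yes refl | _        | _        | yes refl = inj₁ (inj₁ (refl , refl))
  ... | _        | yes refl | yes refl | _        = inj₁ (inj₂ (refl , refl))
  ... | yes refl | _        | _        | no b≢d   =
    inj₂ (inj₁ (inj₁ refl , meetAtApex x ab cd b≢d x∈ab x∈cd))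
  ... | no _     | yes refl | no b≢c   | _        =
    inj₂ (inj₁ (inj₂ refl , meetAtApex x ab (Adj-sym G cd) b≢c x∈ab (reverse x∈cd)))
  ... | no _     | no a≢d   | yes refl | _        =
    inj₂ (inj₂ (inj₁ refl , meetAtApex x (Adj-sym G ab) cd a≢d (reverse x∈ab) x∈cd))
  ... | no a≢c   | no _     | no _     | yes refl =
    inj₂ (inj₂ (inj₂ refl , meetAtApex x (Adj-sym G ab) (Adj-sym G cd) a≢c
                                        (reverse x∈ab) (reverse x∈cd)))
  ... | no a≢c   | no a≢d   | no b≢c   | no b≢d   =
    ⊥-elim (separated⇒disjoint x (pos a) (pos b) (pos c) (pos d)
              (edgesSeparated a b c d ab cd a≢c a≢d b≢c b≢d) x∈ab x∈cd)

  certified⇒planeDrawing : PlaneDrawing G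
  certified⇒planeDrawing = record
    { pos             = pos
    ; injective       = injective
    ; vertexOffEdges  = certified-vertexOffEdges
    ; edgesMeetAtEnds = certified-edgesMeetAtEnds
    }

edges : List (Fin 9 × Fin 9)
edges = (# 0 , # 1) ∷ (# 1 , # 2) ∷ (# 2 , # 0)
      ∷ (# 3 , # 4) ∷ (# 4 , # 5) ∷ (# 5 , # 3)
      ∷ (# 6 , # 7) ∷ (# 7 , # 8) ∷ (# 8 , # 6)
      ∷ (# 0 , # 3) ∷ (# 1 , # 4) ∷ (# 2 , # 5)
      ∷ (# 0 , # 6) ∷ (# 1 , # 7) ∷ (# 2 , # 8) ∷ []

listed : Fin 9 → Fin 9 → Bool
listed u v = any (λ (a , b) → does (u ≟ a) ∧ does (v ≟ b)) edges

G : Graph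
G = record
  { n      = 9
  ; adj    = λ u v → listed u v ∨ listed v u
  ; sym    = λ u v → ∨-comm (listed u v) (listed v u)
  ; irrefl = from-yes (all? λ v → (listed v v ∨ listed v v) ≟ᵇ false)
  }

middle : Subset 9
middle = ⁅ # 0 ⁆ ∪ ⁅ # 1 ⁆ ∪ ⁅ # 2 ⁆

outer∪⁅8⁆ : Subset 9
outer∪⁅8⁆ = ⁅ # 3 ⁆ ∪ ⁅ # 4 ⁆ ∪ ⁅ # 5 ⁆ ∪ ⁅ # 8 ⁆

middle-minimal : MinimalDominating G middle
middle-minimal = from-yes (minimalDominating? G middle)

locally-minimal⇒∣S∣≤3 : ∀ S → Dominating G S → (∀ v → v ∈ S → ¬ Dominating G (S - v)) →
                        ∣ S ∣ ≤ 3
locally-minimal⇒∣S∣≤3 = from-yes (allSubsets? λ S → dominating? G S →-dec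
  (all? λ v → v ∈? S →-dec ¬? (dominating? G (S - v))) →-dec ∣ S ∣ ≤? 3)

Γ≡3 : IsUpperDomination G 3
Γ≡3 = (middle , middle-minimal , refl) , λ S S-minimal →
  locally-minimal⇒∣S∣≤3 S (proj₁ S-minimal) (λ v → minimal⇒¬dominating-removal G S-minimal)

middle-rigid : ∀ T → Dominating G T → ∣ T ∣ ≤ 3 → ∀ m → m ∈ middle → middle ⊆ T ∪ ⁅ m ⁆ → m ∈ T
middle-rigid = from-yes (allSubsets? λ T → dominating? G T →-dec ∣ T ∣ ≤? 3 →-dec
  all? λ m → m ∈? middle →-dec middle ⊆? T ∪ ⁅ m ⁆ →-dec m ∈? T)

middle-preserved : ∀ {X Y : DkVertex G 4} → DkAdj G 4 X Y → middle ⊆ proj₁ X → middle ⊆ proj₁ Y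
middle-preserved {S , _ , ∣S∣≤4} {U , domU , _} (w , Sw≢Uw , agree) middle⊆S {m} m∈middle
  with m ≟ w
... | no m≢w = ∈-agree (agree m m≢w) (middle⊆S m∈middle)
... | yes refl = contradiction (middle-rigid U domU ∣U∣≤3 m m∈middle middle⊆U∪⁅m⁆) m∉U
  where
  m∈S : m ∈ S
  m∈S = middle⊆S m∈middle
  m∉U : m ∉ U
  m∉U m∈U = Sw≢Uw (trans ([]=⇒lookup m∈S) (sym ([]=⇒lookup m∈U)))
  U⊆S-m : U ⊆ S - m
  U⊆S-m {i} i∈U with i ≟ m
  ... | yes refl = contradiction i∈U m∉U
  ... | no i≢m = x∈p∧x≢y⇒x∈p-y (∈-agree (sym (agree i i≢m)) i∈U) i≢m
  ∣U∣≤3 : ∣ U ∣ ≤ 3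
  ∣U∣≤3 = s≤s⁻¹ (<-≤-trans (≤-<-trans (p⊆q⇒∣p∣≤∣q∣ U⊆S-m) (x∈p⇒∣p-x∣<∣p∣ m∈S)) ∣S∣≤4)
  middle⊆U∪⁅m⁆ : middle ⊆ U ∪ ⁅ m ⁆
  middle⊆U∪⁅m⁆ {i} i∈middle with i ≟ m
  ... | yes refl = q⊆p∪q U ⁅ i ⁆ (x∈⁅x⁆ i)
  ... | no i≢m = p⊆p∪q ⁅ m ⁆ (∈-agree (agree i i≢m) (middle⊆S i∈middle))

D₄-disconnected : ¬ Connected (DkVertex G 4) (DkAdj G 4)
D₄-disconnected =
  invariant⇒¬connected (λ X → middle ⊆ proj₁ X) (λ {X} {Y} → middle-preserved {X} {Y})
    (middle , from-yes (dominating? G middle) , from-yes (∣ middle ∣ ≤? 4))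
    (outer∪⁅8⁆ , from-yes (dominating? G outer∪⁅8⁆) , from-yes (∣ outer∪⁅8⁆ ∣ ≤? 4))
    id (from-no (middle ⊆? outer∪⁅8⁆))

point : ℕ → ℕ → Point
point x y = ℤ.+ x / 1 , ℤ.+ y / 1

position : Fin 9 → Point
position = lookup (point 4 3 ∷ point 8 3 ∷ point 6 7
                 ∷ point 0 0 ∷ point 12 0 ∷ point 6 12
                 ∷ point 5 4 ∷ point 7 4 ∷ point 6 5 ∷ [])

directions : List (ℚ × ℚ)
directions = cartesianProduct coefficients coefficients
  where
  coefficients : List ℚ
  coefficients = map (_/ 1) (-[1+ 1 ] ∷ -[1+ 0 ] ∷ ℤ.+ 0 ∷ ℤ.+ 1 ∷ ℤ.+ 2 ∷ [])

certificate : SeparationCertificate G position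
certificate = record
  { injective       = from-yes (all? λ u → all? λ v →
                        ≡-dec ℚ._≟_ ℚ._≟_ (position u) (position v) →-dec u ≟ v)
  ; vertexSeparated = λ a b c ab c≢a c≢b → Any.satisfied (vertexChecks a b c ab c≢a c≢b)
  ; apexSeparated   = λ p q r pq pr q≢r → Any.satisfied (apexChecks p q r pq pr q≢r)
  ; edgesSeparated  = λ a b c d ab cd a≢c a≢d b≢c b≢d →
                        Any.satisfied (edgeChecks a b c d ab cd a≢c a≢d b≢c b≢d)
  }
  where
  adj? : ∀ u v → Dec (Adj G u v)
  adj? u v = adj G u v ≟ᵇ true

  vertexChecks : ∀ a b c → Adj G a b → c ≢ a → c ≢ b →
                 Any (SeparatedBy (position a) (position b) (position c) (position c)) directions
  vertexChecks = from-yes (all? λ a → all? λ b → all? λ c →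
    adj? a b →-dec ¬? (c ≟ a) →-dec ¬? (c ≟ b) →-dec
    Any.any? (separatedBy? (position a) (position b) (position c) (position c)) directions)

  apexChecks : ∀ p q r → Adj G p q → Adj G p r → q ≢ r →
               Any (ApexSeparatedBy (position p) (position q) (position r)) directions
  apexChecks = from-yes (all? λ p → all? λ q → all? λ r →
    adj? p q →-dec adj? p r →-dec ¬? (q ≟ r) →-dec
    Any.any? (apexSeparatedBy? (position p) (position q) (position r)) directions)

  edgeChecks : ∀ a b c d → Adj G a b → Adj G c d → a ≢ c → a ≢ d → b ≢ c → b ≢ d →
               Any (SeparatedBy (position a) (position b) (position c) (position d)) directions
  edgeChecks = from-yes (all? λ a → all? λ b → all? λ c → all? λ d →
    adj? a b →-dec adj? c d →-dec ¬? (a ≟ c) →-dec ¬? (a ≟ d) →-dec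
    ¬? (b ≟ c) →-dec ¬? (b ≟ d) →-dec
    Any.any? (separatedBy? (position a) (position b) (position c) (position d)) directions)

corollary3 : ∃[ G ] ∃[ k ] (Planar G × IsUpperDomination G k ×
    ¬ Connected (DkVertex G (k + 1)) (DkAdj G (k + 1)))
corollary3 = G , 3 , certified⇒planeDrawing certificate , Γ≡3 , D₄-disconnected
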